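{- Let $\Gamma$ be a graph, $k\ge1$, and $\omega\colon E(\Gamma)\to\mathbb{Z}_k$. Let $W=(u_0,\dots,u_m)$ be a closed walk of even length $m$ in $\Gamma$ and let $a$ be the order of $\omega(W)$ in $\mathbb{Z}_k$. Then for every $i\in\mathbb{Z}_k$ and every positive integer $b$, the lift of $W^b$ based at $(u_0,i)$ is a closed walk of $\Gamma^\omega$ if and only if $a\mid b$.
   Context: For a graph $\Gamma$ and a function (weight function) $\omega\colon E(\Gamma)\to\mathbb{Z}_k$, the cross-cover $\Gamma^\omega$ is the graph with vertex set $V(\Gamma)\times\mathbb{Z}_k$ in which, for every edge $e=uv$ of $\Gamma$ and every $i\in\mathbb{Z}_k$, the vertices $(u,i)$ and $(v,\omega(e)-i)$ are adjacent. A walk $W=(u_0,\dots,u_m)$ is a sequence of vertices with consecutive ones adjacent; it is closed if $u_0=u_m$; $W^b$ is the concatenation of $b$ copies of a closed walk $W$. With $e_j=u_ju_{j+1}$, the weight of $W$ is $\omega(W)=\sum_{j=0}^{m-1}(-1)^j\omega(e_j)$. The lift of $W$ based at $(u_0,i)$ is the walk $((u_0,i),(u_1,\omega(e_0)-i),(u_2,\omega(e_1)-\omega(e_0)+i),\dots)$ of $\Gamma^\omega$, i.e. the walk starting at $(u_0,i)$ whose $j$-th vertex lies over $u_j$ and which uses at each step the edge over $e_j$; its last vertex is $(u_m,(-1)^m(i-\omega(W)))$. -}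

module Defs where

open import Data.Nat using (ℕ; zero; suc; _+_; _*_; _∸_; _≤_; NonZero)
open import Data.Nat.DivMod using (_mod_)
open import Data.Fin using (Fin; toℕ)
open import Data.List using (List; []; _∷_; _++_)
open import Data.Product using (_×_; _,_; ∃)
open import Data.Unit using (⊤)
open import Relation.Binary.PropositionalEquality using (_≡_)

Zk : (k : ℕ) → Set
Zk k = Fin k

module _ {k : ℕ} {{_ : NonZero k}} where
  0ₖ : Zk k
  0ₖ = 0 mod k

  _+ₖ_ : Zk k → Zk k → Zk k
  x +ₖ y = (toℕ x + toℕ y) mod k

  -ₖ_ : Zk k → Zk k
  -ₖ x = (k ∸ toℕ x) mod k

  _-ₖ_ : Zk k → Zk k → Zk k
  x -ₖ y = x +ₖ (-ₖ y)

  _·ₖ_ : ℕ → Zk k → Zk k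
  n ·ₖ x = (n * toℕ x) mod k

IsOrder : (k : ℕ) {{_ : NonZero k}} → Zk k → ℕ → Set
IsOrder k x a = (1 ≤ a) × (a ·ₖ x ≡ 0ₖ) × (∀ c → 1 ≤ c → c ·ₖ x ≡ 0ₖ → a ≤ c)

-- A walk (u₀,u₁,…,u_m) is represented by its start u₀ and the list (u₁,…,u_m);
-- its length m is the length of that list.
IsWalk : {A : Set} → (A → A → Set) → A → List A → Set
IsWalk R u [] = ⊤
IsWalk R u (v ∷ vs) = R u v × IsWalk R v vs

lastV : {A : Set} → A → List A → A
lastV u [] = u
lastV u (v ∷ vs) = lastV v vs

IsClosedWalk : {A : Set} → (A → A → Set) → A → List A → Set
IsClosedWalk R u vs = IsWalk R u vs × (lastV u vs ≡ u)

-- W^b for a closed walk W = (u₀ ; rest): the start followed by b copies of rest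
power : {V : Set} → List V → ℕ → List V
power rest zero = []
power rest (suc b) = rest ++ power rest b

module _ {V : Set} {k : ℕ} {{_ : NonZero k}} (ω : V → V → Zk k) where
  -- ω(W) = Σ_j (-1)^j ω(u_j u_{j+1})
  weight : V → List V → Zk k
  weight u [] = 0ₖ
  weight u (v ∷ vs) = ω u v -ₖ weight v vs

  -- lift of the walk (u ; vs) based at (u , i): the list of vertices after (u , i)
  lift : V → Zk k → List V → List (V × Zk k)
  lift u i [] = []
  lift u i (v ∷ vs) = (v , ω u v -ₖ i) ∷ lift v (ω u v -ₖ i) vs

CoverAdj : {V : Set} (Adj : V → V → Set) {k : ℕ} {{_ : NonZero k}} →
           (V → V → Zk k) → (V × Zk k) → (V × Zk k) → Set
CoverAdj Adj ω (u , i) (v , j) = Adj u v × (j ≡ ω u v -ₖ i)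

Even : ℕ → Set
Even m = ∃ λ t → m ≡ t + t

{-# OPTIONS --safe #-}
module Submission where

-- An edge e of Γ acts on the ℤ_k-coordinate of the cross-cover by the reflection
-- j ↦ ω(e) − j, so the lift of a walk of length m from (u₀, i) ends over u_m at
-- (−1)^m (i − ω(W)), where (−1)^m x is written iterate -ₖ_ x m.  The weight is
-- additive under concatenation up to that sign, so for a closed walk W of even
-- length ω(W^b) = b·ω(W) and the lift of W^b ends at (u₀, i − b·ω(W)).  It is
-- closed iff b·ω(W) = 0, i.e. iff the order of ω(W) divides b.

open import Defs

open import Algebra.Bundles using (AbelianGroup)
open import Algebra.Definitions using (Involutive)
import Algebra.Properties.AbelianGroup as AbelianGroupProperties
import Algebra.Properties.CommutativeSemigroup as CommutativeSemigroupProperties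
open import Algebra.Structures using (IsAbelianGroup)
open import Data.Empty using (⊥)
open import Data.Fin using (toℕ)
open import Data.Fin.Properties using (toℕ-fromℕ<; toℕ-injective; toℕ<n)
open import Data.List using (List; []; _∷_; _++_; length)
open import Data.List.Properties using (length-++)
open import Data.Nat
  using (ℕ; zero; suc; _+_; _*_; _∸_; _%_; _/_; _≤_; _<_; z≤n; s≤s; NonZero; >-nonZero; >-nonZero⁻¹)
open import Data.Nat.Divisibility using (_∣_; divides; m%n≡0⇒n∣m; n∣m⇒m%n≡0; ∣n⇒∣m*n; ∣m+n∣m⇒∣n)
open import Data.Nat.DivMod
  using (_mod_; m%n<n; m<n⇒m%n≡m; m%n%n≡m%n; %-distribˡ-+; n%n≡0; m≡m%n+[m/n]*n)
open import Data.Nat.GeneralisedArithmetic using (iterate)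
open import Data.Nat.Properties
  using (+-comm; +-assoc; +-suc; +-identityʳ; *-assoc; *-distribˡ-+; m+[n∸m]≡n; <⇒≤; <⇒≱)
open import Data.Nat.Solver using (module +-*-Solver)
open import Data.Product using (_,_; proj₂)
open import Data.Unit using (tt)
open import Function.Bundles using (_⇔_; mk⇔; Equivalence)
open import Function.Properties.Equivalence using () renaming (trans to ⇔-trans)
open import Level using (0ℓ)
open import Relation.Binary.PropositionalEquality
  using (_≡_; refl; sym; trans; cong; cong₂; subst; isEquivalence; module ≡-Reasoning)
open import Relation.Nullary using (contradiction)

∣m*x∣n*x⇒∣[m%n]*x : ∀ {d} m n x .{{_ : NonZero n}} → d ∣ m * x → d ∣ n * x → d ∣ (m % n) * x
∣m*x∣n*x⇒∣[m%n]*x {d} m n x d∣mx d∣nx =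
  ∣m+n∣m⇒∣n (subst (d ∣_) m*x≡[m/n]*[n*x]+[m%n]*x d∣mx) (∣n⇒∣m*n (m / n) d∣nx)
  where
  open +-*-Solver
  m*x≡[m/n]*[n*x]+[m%n]*x : m * x ≡ m / n * (n * x) + m % n * x
  m*x≡[m/n]*[n*x]+[m%n]*x = trans (cong (_* x) (m≡m%n+[m/n]*n m n))
    (solve 4 (λ r q n x → (r :+ q :* n) :* x := q :* (n :* x) :+ r :* x) refl (m % n) (m / n) n x)

module _ {k : ℕ} {{_ : NonZero k}} where
  open ≡-Reasoning

  toℕ-mod : ∀ n → toℕ (n mod k) ≡ n % k
  toℕ-mod n = toℕ-fromℕ< (m%n<n n k)

  mod-cong-% : ∀ {m n} → m % k ≡ n % k → m mod k ≡ n mod k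
  mod-cong-% {m} {n} e = toℕ-injective (trans (toℕ-mod m) (trans e (sym (toℕ-mod n))))

  toℕ-mod-cancel : ∀ (x : Zk k) → toℕ x mod k ≡ x
  toℕ-mod-cancel x = toℕ-injective (trans (toℕ-mod (toℕ x)) (m<n⇒m%n≡m (toℕ<n x)))

  [m%k+n]%k≡[m+n]%k : ∀ m n → (m % k + n) % k ≡ (m + n) % k
  [m%k+n]%k≡[m+n]%k m n = begin
    (m % k + n) % k         ≡⟨ %-distribˡ-+ (m % k) n k ⟩
    (m % k % k + n % k) % k ≡⟨ cong (λ r → (r + n % k) % k) (m%n%n≡m%n m k) ⟩
    (m % k + n % k) % k     ≡⟨ %-distribˡ-+ m n k ⟨
    (m + n) % k             ∎

  [m+n%k]%k≡[m+n]%k : ∀ m n → (m + n % k) % k ≡ (m + n) % k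
  [m+n%k]%k≡[m+n]%k m n = begin
    (m + n % k) % k ≡⟨ cong (_% k) (+-comm m (n % k)) ⟩
    (n % k + m) % k ≡⟨ [m%k+n]%k≡[m+n]%k n m ⟩
    (n + m) % k     ≡⟨ cong (_% k) (+-comm n m) ⟩
    (m + n) % k     ∎

  0%k≡0 : 0 % k ≡ 0
  0%k≡0 = m<n⇒m%n≡m (>-nonZero⁻¹ k)

  toℕ-0ₖ : toℕ (0ₖ {k}) ≡ 0
  toℕ-0ₖ = trans (toℕ-mod 0) 0%k≡0

  +ₖ-comm : ∀ (x y : Zk k) → x +ₖ y ≡ y +ₖ x
  +ₖ-comm x y = cong (_mod k) (+-comm (toℕ x) (toℕ y))

  +ₖ-assoc : ∀ (x y z : Zk k) → (x +ₖ y) +ₖ z ≡ x +ₖ (y +ₖ z)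
  +ₖ-assoc x y z = mod-cong-% (begin
    (toℕ (x +ₖ y) + toℕ z) % k         ≡⟨ cong (λ r → (r + toℕ z) % k) (toℕ-mod _) ⟩
    ((toℕ x + toℕ y) % k + toℕ z) % k  ≡⟨ [m%k+n]%k≡[m+n]%k _ _ ⟩
    (toℕ x + toℕ y + toℕ z) % k        ≡⟨ cong (_% k) (+-assoc (toℕ x) _ _) ⟩
    (toℕ x + (toℕ y + toℕ z)) % k      ≡⟨ [m+n%k]%k≡[m+n]%k _ _ ⟨
    (toℕ x + (toℕ y + toℕ z) % k) % k  ≡⟨ cong (λ r → (toℕ x + r) % k) (toℕ-mod _) ⟨
    (toℕ x + toℕ (y +ₖ z)) % k         ∎)

  +ₖ-identityʳ : ∀ (x : Zk k) → x +ₖ 0ₖ ≡ x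
  +ₖ-identityʳ x = begin
    (toℕ x + toℕ (0ₖ {k})) mod k ≡⟨ cong (λ r → (toℕ x + r) mod k) toℕ-0ₖ ⟩
    (toℕ x + 0) mod k            ≡⟨ cong (_mod k) (+-identityʳ (toℕ x)) ⟩
    toℕ x mod k                  ≡⟨ toℕ-mod-cancel x ⟩
    x                            ∎

  -ₖ-inverseʳ : ∀ (x : Zk k) → x +ₖ (-ₖ x) ≡ 0ₖ
  -ₖ-inverseʳ x = mod-cong-% (begin
    (toℕ x + toℕ (-ₖ x)) % k         ≡⟨ cong (λ r → (toℕ x + r) % k) (toℕ-mod _) ⟩
    (toℕ x + (k ∸ toℕ x) % k) % k    ≡⟨ [m+n%k]%k≡[m+n]%k _ _ ⟩
    (toℕ x + (k ∸ toℕ x)) % k        ≡⟨ cong (_% k) (m+[n∸m]≡n (<⇒≤ (toℕ<n x))) ⟩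
    k % k                            ≡⟨ n%n≡0 k ⟩
    0                                ≡⟨ 0%k≡0 ⟨
    0 % k                            ∎)

  +ₖ-isAbelianGroup : IsAbelianGroup _≡_ (_+ₖ_ {k}) 0ₖ (-ₖ_)
  +ₖ-isAbelianGroup = record
    { isGroup = record
      { isMonoid = record
        { isSemigroup = record
          { isMagma = record { isEquivalence = isEquivalence ; ∙-cong = cong₂ _+ₖ_ }
          ; assoc = +ₖ-assoc
          }
        ; identity = (λ x → trans (+ₖ-comm 0ₖ x) (+ₖ-identityʳ x)) , +ₖ-identityʳ
        }
      ; inverse = (λ x → trans (+ₖ-comm (-ₖ x) x) (-ₖ-inverseʳ x)) , -ₖ-inverseʳ
      ; ⁻¹-cong = cong (-ₖ_)
      }
    ; comm = +ₖ-comm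
    }

  Zk-abelianGroup : AbelianGroup 0ℓ 0ℓ
  Zk-abelianGroup = record { isAbelianGroup = +ₖ-isAbelianGroup }

  open AbelianGroup Zk-abelianGroup using (commutativeSemigroup; identityˡ; identityʳ; assoc)
  open AbelianGroupProperties Zk-abelianGroup
    using (⁻¹-anti-homo‿-; ⁻¹-∙-comm; ⁻¹-injective; ε⁻¹≈ε; identityʳ-unique)
  open CommutativeSemigroupProperties commutativeSemigroup using (xy∙z≈xz∙y)

  ·ₖ-suc : ∀ n (x : Zk k) → suc n ·ₖ x ≡ x +ₖ (n ·ₖ x)
  ·ₖ-suc n x = mod-cong-% (begin
    (toℕ x + n * toℕ x) % k           ≡⟨ [m+n%k]%k≡[m+n]%k _ _ ⟨
    (toℕ x + n * toℕ x % k) % k       ≡⟨ cong (λ r → (toℕ x + r) % k) (toℕ-mod _) ⟨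
    (toℕ x + toℕ (n ·ₖ x)) % k        ∎)

  ·ₖ≡0ₖ⇔∣ : ∀ n (x : Zk k) → n ·ₖ x ≡ 0ₖ ⇔ k ∣ n * toℕ x
  ·ₖ≡0ₖ⇔∣ n x = mk⇔
    (λ e → m%n≡0⇒n∣m _ k (trans (sym (toℕ-mod _)) (trans (cong toℕ e) toℕ-0ₖ)))
    (λ k∣nx → mod-cong-% (trans (n∣m⇒m%n≡0 _ k k∣nx) (sym 0%k≡0)))

  x-0ₖ≡x : ∀ (x : Zk k) → x -ₖ 0ₖ ≡ x
  x-0ₖ≡x x = trans (cong (x +ₖ_) ε⁻¹≈ε) (identityʳ x)

  x-y≡x⇔y≡0ₖ : ∀ (x y : Zk k) → x -ₖ y ≡ x ⇔ y ≡ 0ₖ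
  x-y≡x⇔y≡0ₖ x y = mk⇔
    (λ e → ⁻¹-injective (trans (identityʳ-unique x (-ₖ y) e) (sym ε⁻¹≈ε)))
    (λ { refl → x-0ₖ≡x x })

  [c-i]-w≡-[i-[c-w]] : ∀ (c i w : Zk k) → (c -ₖ i) -ₖ w ≡ -ₖ (i -ₖ (c -ₖ w))
  [c-i]-w≡-[i-[c-w]] c i w = sym (trans (⁻¹-anti-homo‿- i (c -ₖ w)) (xy∙z≈xz∙y c (-ₖ w) (-ₖ i)))

  x-[y+z]≡x-y-z : ∀ (x y z : Zk k) → x -ₖ (y +ₖ z) ≡ (x -ₖ y) -ₖ z
  x-[y+z]≡x-y-z x y z = trans (cong (x +ₖ_) (sym (⁻¹-∙-comm y z))) (sym (assoc x (-ₖ y) (-ₖ z)))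

  IsOrder⇒·ₖ≡0ₖ⇔∣ : ∀ {x : Zk k} {a} → IsOrder k x a → ∀ b → b ·ₖ x ≡ 0ₖ ⇔ a ∣ b
  IsOrder⇒·ₖ≡0ₖ⇔∣ {x} {a} (1≤a , ax≡0 , a-minimal) b = mk⇔ to from
    where
    instance
      a≢0 : NonZero a
      a≢0 = >-nonZero 1≤a

    k∣ax : k ∣ a * toℕ x
    k∣ax = Equivalence.to (·ₖ≡0ₖ⇔∣ a x) ax≡0

    from : a ∣ b → b ·ₖ x ≡ 0ₖ
    from (divides q refl) = Equivalence.from (·ₖ≡0ₖ⇔∣ (q * a) x)
      (subst (k ∣_) (sym (*-assoc q a (toℕ x))) (∣n⇒∣m*n q k∣ax))

    to : b ·ₖ x ≡ 0ₖ → a ∣ b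
    to bx≡0 with b % a in b%a≡r
    ... | zero  = m%n≡0⇒n∣m b a b%a≡r
    ... | suc r = contradiction a≤1+r (<⇒≱ (subst (_< a) b%a≡r (m%n<n b a)))
      where
      k∣[b%a]x : k ∣ (b % a) * toℕ x
      k∣[b%a]x = ∣m*x∣n*x⇒∣[m%n]*x b a (toℕ x) (Equivalence.to (·ₖ≡0ₖ⇔∣ b x) bx≡0) k∣ax
      a≤1+r : a ≤ suc r
      a≤1+r = a-minimal (suc r) (s≤s z≤n)
        (Equivalence.from (·ₖ≡0ₖ⇔∣ (suc r) x) (subst (λ c → k ∣ c * toℕ x) b%a≡r k∣[b%a]x))

module _ {A : Set} (f : A → A) where

  f∘iterate≡iterate∘f : ∀ x n → f (iterate f x n) ≡ iterate f (f x) n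
  f∘iterate≡iterate∘f x zero    = refl
  f∘iterate≡iterate∘f x (suc n) = f∘iterate≡iterate∘f (f x) n

  iterate-even-involutive : Involutive _≡_ f → ∀ x {n} → Even n → iterate f x n ≡ x
  iterate-even-involutive inv x (t , refl) = iterate-[t+t] x t
    where
    iterate-[t+t] : ∀ x t → iterate f x (t + t) ≡ x
    iterate-[t+t] x zero    = refl
    iterate-[t+t] x (suc t) rewrite +-suc t t =
      trans (iterate-[t+t] (f (f x)) t) (inv x)

Even-* : ∀ b {m} → Even m → Even (b * m)
Even-* b (t , refl) = b * t , *-distribˡ-+ b t t

module _ {A : Set} where

  lastV-++ : ∀ (u : A) xs ys → lastV u (xs ++ ys) ≡ lastV (lastV u xs) ys
  lastV-++ u []       ys = refl
  lastV-++ u (v ∷ xs) ys = lastV-++ v xs ys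

  IsWalk-++ : ∀ {R : A → A → Set} u xs ys →
              IsWalk R u xs → IsWalk R (lastV u xs) ys → IsWalk R u (xs ++ ys)
  IsWalk-++ u []       ys _          w = w
  IsWalk-++ u (v ∷ xs) ys (r , wxs) w = r , IsWalk-++ v xs ys wxs w

  length-power : ∀ (xs : List A) b → length (power xs b) ≡ b * length xs
  length-power xs zero    = refl
  length-power xs (suc b) = trans (length-++ xs) (cong (length xs +_) (length-power xs b))

  lastV-power : ∀ {u : A} {xs} → lastV u xs ≡ u → ∀ b → lastV u (power xs b) ≡ u
  lastV-power          closed zero    = refl
  lastV-power {u} {xs} closed (suc b) = begin
    lastV u (xs ++ power xs b)      ≡⟨ lastV-++ u xs (power xs b) ⟩
    lastV (lastV u xs) (power xs b) ≡⟨ cong (λ v → lastV v (power xs b)) closed ⟩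
    lastV u (power xs b)            ≡⟨ lastV-power closed b ⟩
    u                               ∎
    where open ≡-Reasoning

  IsWalk-power : ∀ {R : A → A → Set} {u xs} → IsClosedWalk R u xs → ∀ b → IsWalk R u (power xs b)
  IsWalk-power              _               zero    = tt
  IsWalk-power {R} {u} {xs} (walk , closed) (suc b) = IsWalk-++ u xs (power xs b) walk
    (subst (λ v → IsWalk R v (power xs b)) (sym closed) (IsWalk-power (walk , closed) b))

module _ {V : Set} {k : ℕ} {{_ : NonZero k}} (ω : V → V → Zk k) where
  open AbelianGroup (Zk-abelianGroup {k}) using (identityˡ)
  open AbelianGroupProperties (Zk-abelianGroup {k}) using (⁻¹-involutive)
  open ≡-Reasoning

  lift-isWalk : ∀ {Adj : V → V → Set} u i vs →
                IsWalk Adj u vs → IsWalk (CoverAdj Adj ω) (u , i) (lift ω u i vs)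
  lift-isWalk u i []       _          = tt
  lift-isWalk u i (v ∷ vs) (uv , walk) = (uv , refl) , lift-isWalk v _ vs walk

  lastV-lift : ∀ u i vs →
    lastV (u , i) (lift ω u i vs) ≡ (lastV u vs , iterate -ₖ_ (i -ₖ weight ω u vs) (length vs))
  lastV-lift u i []       = cong (u ,_) (sym (x-0ₖ≡x i))
  lastV-lift u i (v ∷ vs) = trans (lastV-lift v (ω u v -ₖ i) vs)
    (cong (λ j → lastV v vs , iterate -ₖ_ j (length vs))
          ([c-i]-w≡-[i-[c-w]] (ω u v) i (weight ω v vs)))

  weight-++ : ∀ u xs ys →
    weight ω u (xs ++ ys) ≡ weight ω u xs +ₖ iterate -ₖ_ (weight ω (lastV u xs) ys) (length xs)
  weight-++ u []       ys = sym (identityˡ (weight ω u ys))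
  weight-++ u (v ∷ xs) ys = begin
    ω u v -ₖ weight ω v (xs ++ ys)
      ≡⟨ cong (_-ₖ_ (ω u v)) (weight-++ v xs ys) ⟩
    ω u v -ₖ (weight ω v xs +ₖ iterate -ₖ_ y (length xs))
      ≡⟨ x-[y+z]≡x-y-z (ω u v) (weight ω v xs) _ ⟩
    weight ω u (v ∷ xs) -ₖ iterate -ₖ_ y (length xs)
      ≡⟨ cong (weight ω u (v ∷ xs) +ₖ_) (f∘iterate≡iterate∘f -ₖ_ y (length xs)) ⟩
    weight ω u (v ∷ xs) +ₖ iterate -ₖ_ y (suc (length xs)) ∎
    where y = weight ω (lastV v xs) ys

  module _ {Adj : V → V → Set} {u₀ : V} {rest : List V}
           (W-closed : IsClosedWalk Adj u₀ rest) (W-even : Even (length rest)) where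

    private
      sign-even : ∀ x {n} → Even n → iterate -ₖ_ x n ≡ x
      sign-even = iterate-even-involutive -ₖ_ ⁻¹-involutive

    weight-power : ∀ b → weight ω u₀ (power rest b) ≡ b ·ₖ weight ω u₀ rest
    weight-power zero    = refl
    weight-power (suc b) = begin
      weight ω u₀ (rest ++ power rest b)
        ≡⟨ weight-++ u₀ rest (power rest b) ⟩
      W +ₖ iterate -ₖ_ (weight ω (lastV u₀ rest) (power rest b)) (length rest)
        ≡⟨ cong (W +ₖ_) (sign-even _ W-even) ⟩
      W +ₖ weight ω (lastV u₀ rest) (power rest b)
        ≡⟨ cong (λ v → W +ₖ weight ω v (power rest b)) (proj₂ W-closed) ⟩
      W +ₖ weight ω u₀ (power rest b)
        ≡⟨ cong (W +ₖ_) (weight-power b) ⟩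
      W +ₖ (b ·ₖ W)
        ≡⟨ ·ₖ-suc b W ⟨
      suc b ·ₖ W ∎
      where W = weight ω u₀ rest

    lastV-lift-power : ∀ i b →
      lastV (u₀ , i) (lift ω u₀ i (power rest b)) ≡ (u₀ , i -ₖ (b ·ₖ weight ω u₀ rest))
    lastV-lift-power i b = trans (lastV-lift u₀ i (power rest b))
      (cong₂ _,_ (lastV-power (proj₂ W-closed) b)
        (trans (sign-even _ (subst Even (sym (length-power rest b)) (Even-* b W-even)))
               (cong (_-ₖ_ i) (weight-power b))))

    lift-power-isClosedWalk⇔ : ∀ i b →
      IsClosedWalk (CoverAdj Adj ω) (u₀ , i) (lift ω u₀ i (power rest b)) ⇔
      i -ₖ (b ·ₖ weight ω u₀ rest) ≡ i
    lift-power-isClosedWalk⇔ i b = mk⇔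
      (λ (_ , closed) → cong proj₂ (trans (sym (lastV-lift-power i b)) closed))
      (λ e → lift-isWalk u₀ i (power rest b) (IsWalk-power W-closed b) ,
             trans (lastV-lift-power i b) (cong (u₀ ,_) e))

lemma3p2 : (V : Set) (Adj : V → V → Set) →
           (∀ {u v} → Adj u v → Adj v u) → (∀ {u} → Adj u u → ⊥) →
           (k : ℕ) {{_ : NonZero k}} →
           (ω : V → V → Zk k) → (∀ u v → ω u v ≡ ω v u) →
           (u₀ : V) (rest : List V) → IsClosedWalk Adj u₀ rest →
           Even (length rest) →
           (a : ℕ) → IsOrder k (weight ω u₀ rest) a →
           (i : Zk k) (b : ℕ) → 1 ≤ b →
           (IsClosedWalk (CoverAdj Adj ω) (u₀ , i) (lift ω u₀ i (power rest b)) ⇔ (a ∣ b))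
lemma3p2 V Adj _ _ k ω _ u₀ rest W-closed W-even a order i b _ =
  ⇔-trans (lift-power-isClosedWalk⇔ ω W-closed W-even i b)
  (⇔-trans (x-y≡x⇔y≡0ₖ i (b ·ₖ weight ω u₀ rest))
           (IsOrder⇒·ₖ≡0ₖ⇔∣ order b))
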